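{- The class of 2-terminal directed graphs and the class of directed acyclic graphs are each closed under d-embedding: if $G'$ belongs to the class and $G'$ is d-embedded in $G$, then $G$ belongs to the class.
   Context: A 2-terminal directed graph $\langle V,E,s,t\rangle$ is a directed multigraph without self-loops with distinguished vertices $s,t$ such that every vertex and edge lies on at least one simple directed $s$–$t$ path. d-embeddings: $G'$ is d-embedded in $G$ if $G$ is isomorphic to a graph obtained from $G'$ by a finite (possibly empty) sequence of: (Addition) add a new edge $(a,b)$ between existing vertices such that there is no directed path from $b$ to $a$; (Forward split) replace a vertex $a\neq t$ by vertices $a,b$ and a new edge $(a,b)$, $a$ retaining all incoming edges and the outgoing edges being distributed between $a$ and $b$ with $b$ retaining at least one; (Backward split) replace a vertex $b\neq s$ by vertices $a,b$ and a new edge $(a,b)$, $b$ retaining all outgoing edges and the incoming edges being distributed with $a$ retaining at least one. -}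

module Defs where

open import Data.Nat using (ℕ; zero; suc)
open import Data.Fin using (Fin; zero; suc; _≟_)
open import Data.Empty using (⊥)
open import Data.Bool using (Bool; true; false; if_then_else_; _∧_)
open import Data.List using (List; []; _∷_)
open import Data.List.Membership.Propositional using (_∈_)
open import Data.List.Relation.Unary.Unique.Propositional using (Unique)
open import Data.Product using (Σ; ∃; _×_; _,_)
open import Relation.Nullary using (¬_; does)
open import Relation.Binary.PropositionalEquality using (_≡_; _≢_)
open import Relation.Binary.Construct.Closure.ReflexiveTransitive using (Star)
open import Function.Bundles using (_↔_; Inverse)

-- A finite directed multigraph with two distinguished vertices s and t.
-- Vertices are Fin nV, edges are Fin nE (so parallel edges are allowed),
-- each edge e goes from src e to tgt e.
record Graph : Set where
  constructor graph
  field
    nV  : ℕ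
    nE  : ℕ
    src : Fin nE → Fin nV
    tgt : Fin nE → Fin nV
    s   : Fin nV
    t   : Fin nV
open Graph public

data Walk (G : Graph) : Fin (nV G) → Fin (nV G) → Set where
  nil  : ∀ {u} → Walk G u u
  cons : ∀ {u v} (e : Fin (nE G)) → src G e ≡ u → Walk G (tgt G e) v → Walk G u v

verts : ∀ {G u v} → Walk G u v → List (Fin (nV G))
verts {u = u} nil = u ∷ []
verts {u = u} (cons e _ w) = u ∷ verts w

edges : ∀ {G u v} → Walk G u v → List (Fin (nE G))
edges nil = []
edges (cons e _ w) = e ∷ edges w

Simple : ∀ {G u v} → Walk G u v → Set
Simple w = Unique (verts w)

NoSelfLoops : Graph → Set
NoSelfLoops G = ∀ e → src G e ≢ tgt G e

TwoTerminal : Graph → Set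
TwoTerminal G =
  NoSelfLoops G
  × (∀ (x : Fin (nV G)) → Σ (Walk G (s G) (t G)) λ w → Simple w × x ∈ verts w)
  × (∀ (e : Fin (nE G)) → Σ (Walk G (s G) (t G)) λ w → Simple w × e ∈ edges w)

Acyclic : Graph → Set
Acyclic G = ∀ {u} (e : Fin (nE G)) (p : src G e ≡ u) (w : Walk G (tgt G e) u) → ⊥

-- The three elementary operations.
-- In the resulting graphs, old vertices/edges are `suc x`, the new
-- vertex/edge is `zero`.

addEdge : (G : Graph) → Fin (nV G) → Fin (nV G) → Graph
addEdge (graph n m sr tg s t) a b = graph n (suc m) sr' tg' s t
  where
  sr' : Fin (suc m) → Fin n
  sr' zero = a
  sr' (suc e) = sr e
  tg' : Fin (suc m) → Fin n
  tg' zero = b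
  tg' (suc e) = tg e

-- Forward split of vertex a: new vertex b (= zero), new edge (a , b);
-- outgoing edges e of a with d e ≡ true are moved to b.
fsplit : (G : Graph) → Fin (nV G) → (Fin (nE G) → Bool) → Graph
fsplit (graph n m sr tg s t) a d = graph (suc n) (suc m) sr' tg' (suc s) (suc t)
  where
  sr' : Fin (suc m) → Fin (suc n)
  sr' zero = suc a
  sr' (suc e) = if does (sr e ≟ a) ∧ d e then zero else suc (sr e)
  tg' : Fin (suc m) → Fin (suc n)
  tg' zero = zero
  tg' (suc e) = suc (tg e)

-- Backward split of vertex b: new vertex a (= zero), new edge (a , b);
-- incoming edges e of b with d e ≡ true are moved to a.
bsplit : (G : Graph) → Fin (nV G) → (Fin (nE G) → Bool) → Graph
bsplit (graph n m sr tg s t) b d = graph (suc n) (suc m) sr' tg' (suc s) (suc t)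
  where
  sr' : Fin (suc m) → Fin (suc n)
  sr' zero = zero
  sr' (suc e) = suc (sr e)
  tg' : Fin (suc m) → Fin (suc n)
  tg' zero = suc b
  tg' (suc e) = if does (tg e ≟ b) ∧ d e then zero else suc (tg e)

data Step : Graph → Graph → Set where
  addition : ∀ G (a b : Fin (nV G)) → ¬ Walk G b a → Step G (addEdge G a b)
  forward  : ∀ G (a : Fin (nV G)) (d : Fin (nE G) → Bool) → a ≢ t G →
             (∃ λ e → src G e ≡ a × d e ≡ true) → Step G (fsplit G a d)
  backward : ∀ G (b : Fin (nV G)) (d : Fin (nE G) → Bool) → b ≢ s G →
             (∃ λ e → tgt G e ≡ b × d e ≡ true) → Step G (bsplit G b d)

record Iso (G H : Graph) : Set where
  field
    φV   : Fin (nV G) ↔ Fin (nV H)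
    φE   : Fin (nE G) ↔ Fin (nE H)
    src≡ : ∀ e → Inverse.to φV (src G e) ≡ src H (Inverse.to φE e)
    tgt≡ : ∀ e → Inverse.to φV (tgt G e) ≡ tgt H (Inverse.to φE e)
    s≡   : Inverse.to φV (s G) ≡ s H
    t≡   : Inverse.to φV (t G) ≡ t H

DEmbedded : Graph → Graph → Set
DEmbedded G' G = Σ Graph λ H → Star Step G' H × Iso H G

module Submission where

-- Both properties are preserved by each elementary operation and by isomorphism.
-- An added edge (a , b) with no path from b to a closes no cycle, and it lies on the
-- simple s–t path formed by an s–a prefix and a b–t suffix of simple s–t paths: these
-- are disjoint, as a common vertex would give a path from b to a. A forward split is
-- handled by contracting the new edge (acyclicity) and by lifting simple paths, inserting
-- the new edge in front of every moved edge (2-terminality). A backward split is the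
-- transpose of a forward split of the transpose, and transposition preserves both properties.

open import Defs
open import Data.Bool using (Bool; true; false; T; if_then_else_; _∧_)
open import Data.Fin using (Fin; zero; suc; _≟_)
open import Data.Empty using (⊥-elim)
open import Data.List using (List; []; _∷_; _++_; [_]; map; reverse)
open import Data.List.Properties using (map-id; unfold-reverse)
open import Data.List.Membership.Propositional using (_∈_)
open import Data.List.Membership.Propositional.Properties using (∈-map⁺)
open import Data.List.Relation.Binary.Disjoint.Propositional using (Disjoint)
open import Data.List.Relation.Binary.Permutation.Propositional using (↭-sym; ↭⇒↭ₛ)
open import Data.List.Relation.Binary.Permutation.Propositional.Properties using (↭-reverse)
open import Data.List.Relation.Binary.Permutation.Setoid.Properties using (Unique-resp-↭)
open import Data.List.Relation.Unary.All using ([]; _∷_)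
open import Data.List.Relation.Unary.All.Properties using (¬Any⇒All¬)
open import Data.List.Relation.Unary.Any using (here; there)
open import Data.List.Relation.Unary.Any.Properties using (reverse⁺)
open import Data.List.Relation.Unary.Unique.Propositional using (Unique; []; _∷_)
open import Data.List.Relation.Unary.Unique.Propositional.Properties using (map⁺; ++⁺; Unique[x∷xs]⇒x∉xs)
open import Data.Product using (Σ; ∃; _×_; _,_; proj₁; proj₂)
open import Data.Sum using (_⊎_; inj₁; inj₂; map₁)
open import Data.Unit using (tt)
open import Function using (id; _∘_)
open import Function.Bundles using (Inverse; Injection)
open import Function.Construct.Identity using (↔-id)
open import Function.Properties.Inverse using (↔-sym; ↔⇒↣)
open import Relation.Binary.Construct.Closure.ReflexiveTransitive using (fold)
open import Relation.Binary.PropositionalEquality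
  using (_≡_; refl; sym; trans; cong; subst; subst₂; setoid; module ≡-Reasoning)
open import Relation.Nullary using (¬_; does; yes; no)

VertexOnSTPath : (G : Graph) → Fin (nV G) → Set
VertexOnSTPath G x = Σ (Walk G (s G) (t G)) λ w → Simple w × x ∈ verts w

EdgeOnSTPath : (G : Graph) → Fin (nE G) → Set
EdgeOnSTPath G e = Σ (Walk G (s G) (t G)) λ w → Simple w × e ∈ edges w

Unique-reverse : ∀ {A : Set} {xs : List A} → Unique xs → Unique (reverse xs)
Unique-reverse {A} {xs} = Unique-resp-↭ (setoid A) (↭⇒↭ₛ (↭-sym (↭-reverse xs)))

module _ {G : Graph} where

  infixr 5 _++ʷ_
  _++ʷ_ : ∀ {u v w} → Walk G u v → Walk G v w → Walk G u w
  nil ++ʷ q = q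
  cons e r p ++ʷ q = cons e r (p ++ʷ q)

  tailVerts : ∀ {u v} → Walk G u v → List (Fin (nV G))
  tailVerts nil = []
  tailVerts (cons _ _ w) = verts w

  verts-++ʷ : ∀ {u v w} (p : Walk G u v) (q : Walk G v w) → verts (p ++ʷ q) ≡ verts p ++ tailVerts q
  verts-++ʷ nil nil = refl
  verts-++ʷ nil (cons _ _ _) = refl
  verts-++ʷ (cons _ _ p) q = cong (_ ∷_) (verts-++ʷ p q)

  edges-++ʷ : ∀ {u v w} (p : Walk G u v) (q : Walk G v w) → edges (p ++ʷ q) ≡ edges p ++ edges q
  edges-++ʷ nil q = refl
  edges-++ʷ (cons e _ p) q = cong (e ∷_) (edges-++ʷ p q)

  head∈verts : ∀ {u v} (w : Walk G u v) → u ∈ verts w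
  head∈verts nil = here refl
  head∈verts (cons _ _ _) = here refl

  tgt∈verts : ∀ {u v e} (w : Walk G u v) → e ∈ edges w → tgt G e ∈ verts w
  tgt∈verts (cons _ _ w) (here refl) = there (head∈verts w)
  tgt∈verts (cons _ _ w) (there e∈) = there (tgt∈verts w e∈)

  ∈-verts-++ʷ⁺ˡ : ∀ {u v w x} (p : Walk G u v) {q : Walk G v w} → x ∈ verts p → x ∈ verts (p ++ʷ q)
  ∈-verts-++ʷ⁺ˡ nil {q} (here refl) = head∈verts q
  ∈-verts-++ʷ⁺ˡ (cons _ _ _) (here refl) = here refl
  ∈-verts-++ʷ⁺ˡ (cons _ _ p) (there x∈) = there (∈-verts-++ʷ⁺ˡ p x∈)

  ∈-verts-++ʷ⁺ʳ : ∀ {u v w x} (p : Walk G u v) {q : Walk G v w} → x ∈ verts q → x ∈ verts (p ++ʷ q)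
  ∈-verts-++ʷ⁺ʳ nil x∈ = x∈
  ∈-verts-++ʷ⁺ʳ (cons _ _ p) x∈ = there (∈-verts-++ʷ⁺ʳ p x∈)

  ∈-verts-++ʷ⁻ : ∀ {u v w x} (p : Walk G u v) {q : Walk G v w} →
                 x ∈ verts (p ++ʷ q) → x ∈ verts p ⊎ x ∈ verts q
  ∈-verts-++ʷ⁻ nil x∈ = inj₂ x∈
  ∈-verts-++ʷ⁻ (cons _ _ _) (here refl) = inj₁ (here refl)
  ∈-verts-++ʷ⁻ (cons _ _ p) (there x∈) = map₁ there (∈-verts-++ʷ⁻ p x∈)

  ∈-edges-++ʷ⁺ˡ : ∀ {u v w f} (p : Walk G u v) {q : Walk G v w} → f ∈ edges p → f ∈ edges (p ++ʷ q)
  ∈-edges-++ʷ⁺ˡ (cons _ _ _) (here refl) = here refl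
  ∈-edges-++ʷ⁺ˡ (cons _ _ p) (there f∈) = there (∈-edges-++ʷ⁺ˡ p f∈)

  ∈-edges-++ʷ⁺ʳ : ∀ {u v w f} (p : Walk G u v) {q : Walk G v w} → f ∈ edges q → f ∈ edges (p ++ʷ q)
  ∈-edges-++ʷ⁺ʳ nil f∈ = f∈
  ∈-edges-++ʷ⁺ʳ (cons _ _ p) f∈ = there (∈-edges-++ʷ⁺ʳ p f∈)

  splitAt : ∀ {u v x} (w : Walk G u v) → x ∈ verts w →
            Σ (Walk G u x) λ p → Σ (Walk G x v) λ q → w ≡ p ++ʷ q
  splitAt nil (here refl) = nil , nil , refl
  splitAt (cons e r w) (here refl) = nil , cons e r w , refl
  splitAt (cons e r w) (there x∈) =
    let p , q , w≡p++q = splitAt w x∈ in cons e r p , q , cong (cons e r) w≡p++q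

  simple-++ʷ⁻ : ∀ {u v w} (p : Walk G u v) (q : Walk G v w) → Simple (p ++ʷ q) → Simple p × Simple q
  simple-++ʷ⁻ nil q sq = [] ∷ [] , sq
  simple-++ʷ⁻ (cons e r p) q s@(_ ∷ s′) =
    let sp , sq = simple-++ʷ⁻ p q s′
    in ¬Any⇒All¬ _ (Unique[x∷xs]⇒x∉xs s ∘ ∈-verts-++ʷ⁺ˡ p) ∷ sp , sq

  simple-++ʷ-cons : ∀ {u v w} (p : Walk G u v) e (r : src G e ≡ v) (q : Walk G (tgt G e) w) →
                    Simple p → Simple q → Disjoint (verts p) (verts q) → Simple (p ++ʷ cons e r q)
  simple-++ʷ-cons p e r q sp sq disjoint =
    subst Unique (sym (verts-++ʷ p (cons e r q))) (++⁺ sp sq disjoint)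

record Hom (G H : Graph) : Set where
  field
    vertex  : Fin (nV G) → Fin (nV H)
    edge    : Fin (nE G) → Fin (nE H)
    src-hom : ∀ e → vertex (src G e) ≡ src H (edge e)
    tgt-hom : ∀ e → vertex (tgt G e) ≡ tgt H (edge e)
    s-hom   : vertex (s G) ≡ s H
    t-hom   : vertex (t G) ≡ t H

module _ {G H : Graph} (f : Hom G H) where
  open Hom f

  mapWalk : ∀ {u v x y} → Walk G u v → vertex u ≡ x → vertex v ≡ y → Walk H x y
  mapWalk nil refl refl = nil
  mapWalk (cons e r w) refl q =
    cons (edge e) (trans (sym (src-hom e)) (cong vertex r)) (mapWalk w (tgt-hom e) q)

  verts-mapWalk : ∀ {u v x y} (w : Walk G u v) (p : vertex u ≡ x) (q : vertex v ≡ y) →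
                  verts (mapWalk w p q) ≡ map vertex (verts w)
  verts-mapWalk nil refl refl = refl
  verts-mapWalk (cons e _ w) refl q = cong (_ ∷_) (verts-mapWalk w (tgt-hom e) q)

  edges-mapWalk : ∀ {u v x y} (w : Walk G u v) (p : vertex u ≡ x) (q : vertex v ≡ y) →
                  edges (mapWalk w p q) ≡ map edge (edges w)
  edges-mapWalk nil refl refl = refl
  edges-mapWalk (cons e _ w) refl q = cong (_ ∷_) (edges-mapWalk w (tgt-hom e) q)

  noSelfLoops-reflect : NoSelfLoops H → NoSelfLoops G
  noSelfLoops-reflect noLoops e loop =
    noLoops (edge e) (trans (sym (src-hom e)) (trans (cong vertex loop) (tgt-hom e)))

  acyclic-reflect : Acyclic H → Acyclic G
  acyclic-reflect acyclic e r w =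
    acyclic (edge e) (trans (sym (src-hom e)) (cong vertex r)) (mapWalk w (tgt-hom e) refl)

  module _ (vertex-injective : ∀ {x y} → vertex x ≡ vertex y → x ≡ y) where

    mapWalk-simple : ∀ {u v x y} (w : Walk G u v) (p : vertex u ≡ x) (q : vertex v ≡ y) →
                     Simple w → Simple (mapWalk w p q)
    mapWalk-simple w p q sw = subst Unique (sym (verts-mapWalk w p q)) (map⁺ vertex-injective sw)

    vertexOnSTPath-map : ∀ {x} → VertexOnSTPath G x → VertexOnSTPath H (vertex x)
    vertexOnSTPath-map (w , sw , x∈) =
      mapWalk w s-hom t-hom , mapWalk-simple w s-hom t-hom sw ,
      subst (_ ∈_) (sym (verts-mapWalk w s-hom t-hom)) (∈-map⁺ vertex x∈)

    edgeOnSTPath-map : ∀ {e} → EdgeOnSTPath G e → EdgeOnSTPath H (edge e)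
    edgeOnSTPath-map (w , sw , e∈) =
      mapWalk w s-hom t-hom , mapWalk-simple w s-hom t-hom sw ,
      subst (_ ∈_) (sym (edges-mapWalk w s-hom t-hom)) (∈-map⁺ edge e∈)

module _ {G H : Graph} (I : Iso G H) where
  open Iso I
  private
    module V = Inverse φV
    module E = Inverse φE

  isoHom : Hom G H
  isoHom = record
    { vertex = V.to ; edge = E.to ; src-hom = src≡ ; tgt-hom = tgt≡ ; s-hom = s≡ ; t-hom = t≡ }

  iso-sym : Iso H G
  iso-sym = record
    { φV = ↔-sym φV ; φE = ↔-sym φE
    ; src≡ = from-end src src≡ ; tgt≡ = from-end tgt tgt≡
    ; s≡ = V.inverseʳ (sym s≡) ; t≡ = V.inverseʳ (sym t≡)
    }
    where
    open ≡-Reasoning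

    from-end : (end : (K : Graph) → Fin (nE K) → Fin (nV K)) →
               (∀ e → V.to (end G e) ≡ end H (E.to e)) → ∀ e → V.from (end H e) ≡ end G (E.from e)
    from-end end end≡ e = begin
      V.from (end H e)                   ≡⟨ cong (V.from ∘ end H) (sym (E.strictlyInverseˡ e)) ⟩
      V.from (end H (E.to (E.from e)))   ≡⟨ V.inverseʳ (sym (end≡ (E.from e))) ⟩
      end G (E.from e)                   ∎

iso-twoTerminal : ∀ {G H} → Iso G H → TwoTerminal G → TwoTerminal H
iso-twoTerminal {G} {H} I (noLoops , onV , onE) =
  noSelfLoops-reflect (isoHom (iso-sym I)) noLoops ,
  (λ x → subst (VertexOnSTPath H) (V.strictlyInverseˡ x) (vertexOnSTPath-map f injective (onV (V.from x)))) ,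
  (λ e → subst (EdgeOnSTPath H) (E.strictlyInverseˡ e) (edgeOnSTPath-map f injective (onE (E.from e))))
  where
  module V = Inverse (Iso.φV I)
  module E = Inverse (Iso.φE I)
  f : Hom G H
  f = isoHom I
  injective : ∀ {x y} → V.to x ≡ V.to y → x ≡ y
  injective = Injection.injective (↔⇒↣ (Iso.φV I))

iso-acyclic : ∀ {G H} → Iso G H → Acyclic G → Acyclic H
iso-acyclic I = acyclic-reflect (isoHom (iso-sym I))

addEdge-inclusion : ∀ G a b → Hom G (addEdge G a b)
addEdge-inclusion G a b = record
  { vertex = id ; edge = suc
  ; src-hom = λ _ → refl ; tgt-hom = λ _ → refl ; s-hom = refl ; t-hom = refl
  }

module _ {G : Graph} {a b : Fin (nV G)} (b↛a : ¬ Walk G b a) where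
  private
    G⁺ : Graph
    G⁺ = addEdge G a b

    inclusion : Hom G G⁺
    inclusion = addEdge-inclusion G a b

  -- a walk of G⁺ uses the new edge at most once, as using it twice needs a path from b to a
  addEdge-walk⁻ : ∀ {u v} → Walk G⁺ u v → Walk G u v ⊎ (Walk G u a × Walk G b v)
  addEdge-walk⁻ nil = inj₁ nil
  addEdge-walk⁻ (cons zero refl w) with addEdge-walk⁻ w
  ... | inj₁ b⇝v = inj₂ (nil , b⇝v)
  ... | inj₂ (b⇝a , _) = ⊥-elim (b↛a b⇝a)
  addEdge-walk⁻ (cons (suc e) r w) with addEdge-walk⁻ w
  ... | inj₁ w′ = inj₁ (cons e r w′)
  ... | inj₂ (w₁ , w₂) = inj₂ (cons e r w₁ , w₂)

  addEdge-acyclic : Acyclic G → Acyclic G⁺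
  addEdge-acyclic acyclic zero refl w with addEdge-walk⁻ w
  ... | inj₁ b⇝a = b↛a b⇝a
  ... | inj₂ (b⇝a , _) = b↛a b⇝a
  addEdge-acyclic acyclic (suc e) refl w with addEdge-walk⁻ w
  ... | inj₁ w′ = acyclic e refl w′
  ... | inj₂ (tgt⇝a , b⇝src) = b↛a (b⇝src ++ʷ cons e refl tgt⇝a)

  private
    lift : ∀ {u v} → Walk G u v → Walk G⁺ u v
    lift w = mapWalk inclusion w refl refl

    verts-lift : ∀ {u v} (w : Walk G u v) → verts (lift w) ≡ verts w
    verts-lift w = trans (verts-mapWalk inclusion w refl refl) (map-id (verts w))

    lift-simple : ∀ {u v} (w : Walk G u v) → Simple w → Simple (lift w)
    lift-simple w = mapWalk-simple inclusion id w refl refl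

  newEdgeOnSTPath : TwoTerminal G → EdgeOnSTPath G⁺ zero
  newEdgeOnSTPath (_ , onV , _) with onV a | onV b
  ... | W₁ , sW₁ , a∈ | W₂ , sW₂ , b∈ with splitAt W₁ a∈ | splitAt W₂ b∈
  ... | P , P′ , refl | Q′ , Q , refl =
    lift P ++ʷ cons zero refl (lift Q) ,
    simple-++ʷ-cons (lift P) zero refl (lift Q) (lift-simple P sP) (lift-simple Q sQ)
      (subst₂ Disjoint (sym (verts-lift P)) (sym (verts-lift Q)) disjoint) ,
    ∈-edges-++ʷ⁺ʳ (lift P) (here refl)
    where
    sP : Simple P
    sP = proj₁ (simple-++ʷ⁻ P P′ sW₁)
    sQ : Simple Q
    sQ = proj₂ (simple-++ʷ⁻ Q′ Q sW₂)
    disjoint : Disjoint (verts P) (verts Q)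
    disjoint (x∈P , x∈Q) with splitAt P x∈P | splitAt Q x∈Q
    ... | _ , x⇝a , _ | b⇝x , _ , _ = b↛a (b⇝x ++ʷ x⇝a)

  addEdge-twoTerminal : TwoTerminal G → TwoTerminal G⁺
  addEdge-twoTerminal twoTerminal@(noLoops , onV , onE) =
    noLoops⁺ , vertexOnSTPath-map inclusion id ∘ onV , onE⁺
    where
    noLoops⁺ : NoSelfLoops G⁺
    noLoops⁺ zero refl = b↛a nil
    noLoops⁺ (suc e) = noLoops e
    onE⁺ : ∀ e → EdgeOnSTPath G⁺ e
    onE⁺ zero = newEdgeOnSTPath twoTerminal
    onE⁺ (suc e) = edgeOnSTPath-map inclusion id (onE e)

module ForwardSplit (G : Graph) (a : Fin (nV G)) (d : Fin (nE G) → Bool) where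
  private
    G′ : Graph
    G′ = fsplit G a d

  moved : Fin (nE G) → Bool
  moved e = does (src G e ≟ a) ∧ d e

  moved⇒src≡a : ∀ e → T (moved e) → src G e ≡ a
  moved⇒src≡a e m with src G e ≟ a
  ... | yes src≡a = src≡a
  ... | no _      = ⊥-elim m

  moved-intro : ∀ e → src G e ≡ a → d e ≡ true → T (moved e)
  moved-intro e src≡a d≡true with src G e ≟ a
  ... | yes _    = subst T (sym d≡true) tt
  ... | no src≢a = ⊥-elim (src≢a src≡a)

  contract : Fin (nV G′) → Fin (nV G)
  contract zero = a
  contract (suc x) = x

  contract-if : ∀ u m → (T m → u ≡ a) → contract (if m then zero else suc u) ≡ u
  contract-if u true  u≡a = sym (u≡a tt)
  contract-if u false _   = refl

  contract-src : ∀ e → contract (src G′ (suc e)) ≡ src G e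
  contract-src e = contract-if (src G e) (moved e) (moved⇒src≡a e)

  contractWalk : ∀ {x y} → Walk G′ x y → Walk G (contract x) (contract y)
  contractWalk nil = nil
  contractWalk (cons zero refl w) = contractWalk w
  contractWalk (cons (suc e) refl w) = cons e (sym (contract-src e)) (contractWalk w)

  fsplit-acyclic : Acyclic G → Acyclic G′
  fsplit-acyclic acyclic (suc e) refl w = acyclic e (sym (contract-src e)) (contractWalk w)
  -- a cycle through the new edge goes on with a moved edge, whose source in G is a
  fsplit-acyclic acyclic zero refl (cons zero () _)
  fsplit-acyclic acyclic zero refl (cons (suc e) r w) =
    acyclic e (trans (sym (contract-src e)) (cong contract r)) (contractWalk w)

  toSource′ : ∀ u m → (T m → u ≡ a) → Walk G′ (suc u) (if m then zero else suc u)
  toSource′ u true  u≡a = cons zero (cong suc (sym (u≡a tt))) nil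
  toSource′ u false _   = nil

  toSource : ∀ e → Walk G′ (suc (src G e)) (src G′ (suc e))
  toSource e = toSource′ (src G e) (moved e) (moved⇒src≡a e)

  toSource′-simple : ∀ u m h → Simple (toSource′ u m h)
  toSource′-simple _ true  _ = ((λ ()) ∷ []) ∷ [] ∷ []
  toSource′-simple _ false _ = [] ∷ []

  contract-toSource′ : ∀ {y} u m h → y ∈ verts (toSource′ u m h) → contract y ≡ u
  contract-toSource′ _ true  _   (here refl)         = refl
  contract-toSource′ _ true  u≡a (there (here refl)) = sym (u≡a tt)
  contract-toSource′ _ false _   (here refl)         = refl

  toSource′-newEdge : ∀ u m h → T m → zero ∈ edges (toSource′ u m h)
  toSource′-newEdge _ true _ _ = here refl

  lift : ∀ {u v} → Walk G u v → Walk G′ (suc u) (suc v)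
  lift nil = nil
  lift (cons e refl w) = toSource e ++ʷ cons (suc e) refl (lift w)

  contract-lift⁻ : ∀ {u v y} (w : Walk G u v) → y ∈ verts (lift w) → contract y ∈ verts w
  contract-lift⁻ nil (here refl) = here refl
  contract-lift⁻ (cons e refl w) y∈ with ∈-verts-++ʷ⁻ (toSource e) y∈
  ... | inj₁ y∈₁ = here (contract-toSource′ _ _ _ y∈₁)
  ... | inj₂ (here refl) = here (contract-src e)
  ... | inj₂ (there y∈₂) = there (contract-lift⁻ w y∈₂)

  lift-simple : ∀ {u v} (w : Walk G u v) → Simple w → Simple (lift w)
  lift-simple nil _ = [] ∷ []
  lift-simple (cons e refl w) s@(_ ∷ sw) =
    simple-++ʷ-cons (toSource e) (suc e) refl (lift w)
      (toSource′-simple _ _ _) (lift-simple w sw) disjoint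
    where
    disjoint : Disjoint (verts (toSource e)) (verts (lift w))
    disjoint (y∈₁ , y∈₂) =
      Unique[x∷xs]⇒x∉xs s
        (subst (_∈ verts w) (contract-toSource′ _ _ _ y∈₁) (contract-lift⁻ w y∈₂))

  ∈-verts-lift⁺ : ∀ {u v x} (w : Walk G u v) → x ∈ verts w → suc x ∈ verts (lift w)
  ∈-verts-lift⁺ nil (here refl) = here refl
  ∈-verts-lift⁺ (cons e refl w) (here refl) = ∈-verts-++ʷ⁺ˡ (toSource e) (head∈verts (toSource e))
  ∈-verts-lift⁺ (cons e refl w) (there x∈) = ∈-verts-++ʷ⁺ʳ (toSource e) (there (∈-verts-lift⁺ w x∈))

  ∈-edges-lift⁺ : ∀ {u v f} (w : Walk G u v) → f ∈ edges w → suc f ∈ edges (lift w)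
  ∈-edges-lift⁺ (cons e refl w) (here refl) = ∈-edges-++ʷ⁺ʳ (toSource e) (here refl)
  ∈-edges-lift⁺ (cons e refl w) (there f∈) = ∈-edges-++ʷ⁺ʳ (toSource e) (there (∈-edges-lift⁺ w f∈))

  newEdge∈lift : ∀ {u v f} (w : Walk G u v) → f ∈ edges w → T (moved f) → zero ∈ edges (lift w)
  newEdge∈lift (cons e refl w) (here refl) m =
    ∈-edges-++ʷ⁺ˡ (toSource e) (toSource′-newEdge _ _ _ m)
  newEdge∈lift (cons e refl w) (there f∈) m = ∈-edges-++ʷ⁺ʳ (toSource e) (there (newEdge∈lift w f∈ m))

  fsplit-twoTerminal : (∃ λ e → src G e ≡ a × d e ≡ true) → TwoTerminal G → TwoTerminal G′
  fsplit-twoTerminal (e₀ , src≡a , d≡true) (noLoops , onV , onE) = noLoops′ , onV′ , onE′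
    where
    noLoops′ : NoSelfLoops G′
    noLoops′ zero ()
    noLoops′ (suc e) loop = noLoops e (trans (sym (contract-src e)) (cong contract loop))

    onE′ : ∀ e → EdgeOnSTPath G′ e
    onE′ zero    = let w , sw , e₀∈ = onE e₀
                   in lift w , lift-simple w sw , newEdge∈lift w e₀∈ (moved-intro e₀ src≡a d≡true)
    onE′ (suc e) = let w , sw , e∈ = onE e in lift w , lift-simple w sw , ∈-edges-lift⁺ w e∈

    onV′ : ∀ x → VertexOnSTPath G′ x
    onV′ zero    = let w , sw , zero∈ = onE′ zero in w , sw , tgt∈verts w zero∈
    onV′ (suc x) = let w , sw , x∈ = onV x in lift w , lift-simple w sw , ∈-verts-lift⁺ w x∈

transpose : Graph → Graph
transpose G = graph (nV G) (nE G) (tgt G) (src G) (t G) (s G)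

module _ {G : Graph} where
  open ≡-Reasoning

  reverseWalk : ∀ {u v} → Walk G u v → Walk (transpose G) v u
  reverseWalk nil = nil
  reverseWalk (cons e refl w) = reverseWalk w ++ʷ cons e refl nil

  verts-reverseWalk : ∀ {u v} (w : Walk G u v) → verts (reverseWalk w) ≡ reverse (verts w)
  verts-reverseWalk nil = refl
  verts-reverseWalk (cons e refl w) = begin
    verts (reverseWalk w ++ʷ cons e refl nil) ≡⟨ verts-++ʷ (reverseWalk w) (cons e refl nil) ⟩
    verts (reverseWalk w) ++ [ src G e ]      ≡⟨ cong (_++ [ src G e ]) (verts-reverseWalk w) ⟩
    reverse (verts w) ++ [ src G e ]          ≡⟨ unfold-reverse (src G e) (verts w) ⟨
    reverse (src G e ∷ verts w)               ∎

  edges-reverseWalk : ∀ {u v} (w : Walk G u v) → edges (reverseWalk w) ≡ reverse (edges w)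
  edges-reverseWalk nil = refl
  edges-reverseWalk (cons e refl w) = begin
    edges (reverseWalk w ++ʷ cons e refl nil) ≡⟨ edges-++ʷ (reverseWalk w) (cons e refl nil) ⟩
    edges (reverseWalk w) ++ [ e ]            ≡⟨ cong (_++ [ e ]) (edges-reverseWalk w) ⟩
    reverse (edges w) ++ [ e ]                ≡⟨ unfold-reverse e (edges w) ⟨
    reverse (e ∷ edges w)                     ∎

  reverseWalk-simple : ∀ {u v} (w : Walk G u v) → Simple w → Simple (reverseWalk w)
  reverseWalk-simple w sw = subst Unique (sym (verts-reverseWalk w)) (Unique-reverse sw)

transpose-twoTerminal : ∀ {G} → TwoTerminal G → TwoTerminal (transpose G)
transpose-twoTerminal (noLoops , onV , onE) =
  (λ e loop → noLoops e (sym loop)) ,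
  (λ x → let w , sw , x∈ = onV x in
    reverseWalk w , reverseWalk-simple w sw , subst (x ∈_) (sym (verts-reverseWalk w)) (reverse⁺ x∈)) ,
  (λ e → let w , sw , e∈ = onE e in
    reverseWalk w , reverseWalk-simple w sw , subst (e ∈_) (sym (edges-reverseWalk w)) (reverse⁺ e∈))

transpose-acyclic : ∀ {G} → Acyclic G → Acyclic (transpose G)
transpose-acyclic acyclic e refl w = acyclic e refl (reverseWalk w)

transpose-fsplit-transpose≅bsplit : ∀ G b d → Iso (transpose (fsplit (transpose G) b d)) (bsplit G b d)
transpose-fsplit-transpose≅bsplit G b d = record
  { φV = ↔-id _ ; φE = ↔-id _
  ; src≡ = λ { zero → refl ; (suc _) → refl }
  ; tgt≡ = λ { zero → refl ; (suc _) → refl }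
  ; s≡ = refl ; t≡ = refl
  }

bsplit-twoTerminal : ∀ {G b d} → (∃ λ e → tgt G e ≡ b × d e ≡ true) →
                     TwoTerminal G → TwoTerminal (bsplit G b d)
bsplit-twoTerminal {G} {b} {d} moved =
  iso-twoTerminal (transpose-fsplit-transpose≅bsplit G b d) ∘ transpose-twoTerminal ∘
  ForwardSplit.fsplit-twoTerminal (transpose G) b d moved ∘ transpose-twoTerminal

bsplit-acyclic : ∀ {G b d} → Acyclic G → Acyclic (bsplit G b d)
bsplit-acyclic {G} {b} {d} =
  iso-acyclic (transpose-fsplit-transpose≅bsplit G b d) ∘ transpose-acyclic ∘
  ForwardSplit.fsplit-acyclic (transpose G) b d ∘ transpose-acyclic

step-twoTerminal : ∀ {G H} → Step G H → TwoTerminal G → TwoTerminal H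
step-twoTerminal (addition G a b b↛a)    = addEdge-twoTerminal b↛a
step-twoTerminal (forward G a d _ moved)  = ForwardSplit.fsplit-twoTerminal G a d moved
step-twoTerminal (backward G b d _ moved) = bsplit-twoTerminal moved

step-acyclic : ∀ {G H} → Step G H → Acyclic G → Acyclic H
step-acyclic (addition G a b b↛a) = addEdge-acyclic b↛a
step-acyclic (forward G a d _ _)   = ForwardSplit.fsplit-acyclic G a d
step-acyclic (backward G b d _ _)  = bsplit-acyclic

dEmbedded-preserves : (P : Graph → Set) →
                      (∀ {G H} → Step G H → P G → P H) → (∀ {G H} → Iso G H → P G → P H) →
                      ∀ {G′ G} → P G′ → DEmbedded G′ G → P G
dEmbedded-preserves P P-step P-iso pG′ (H , steps , G′≅H) =
  P-iso G′≅H (fold (λ G H → P G → P H) (λ step k → k ∘ P-step step) id steps pG′)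

lemma7 : (∀ (G' G : Graph) → TwoTerminal G' → DEmbedded G' G → TwoTerminal G)
         × (∀ (G' G : Graph) → Acyclic G' → DEmbedded G' G → Acyclic G)
lemma7 = (λ _ _ → dEmbedded-preserves TwoTerminal step-twoTerminal iso-twoTerminal)
       , (λ _ _ → dEmbedded-preserves Acyclic step-acyclic iso-acyclic)
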